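{- For every $q\ge2$ and every integer $t\ge3$, $N'_q(t)\le N_q(t)$.
   Context: Let $Q=\{0,\dots,q-1\}$; for a nonempty $X=\{\mathbf c^1,\dots,\mathbf c^s\}\subseteq Q^n$ let $U(X)=\{i: c^1_i=\dots=c^s_i\}$ and $\mathrm{wdesc}(X)=\{\mathbf y\in Q^n: y_i=c^1_i\ \forall i\in U(X)\}$; a code $\mathcal C\subseteq Q^n$ is a wide-sense $t$-frameproof code if $\mathrm{wdesc}(X)\cap\mathcal C=X$ for every nonempty $X\subseteq\mathcal C$ with $|X|\le t$. The representation matrix of $\mathcal C$ is the $n\times|\mathcal C|$ matrix whose columns are its codewords; it is in standard form if in each row $r$, writing $\lambda_i(r)$ for the number of entries equal to $i$, we have $\lambda_0(r)\ge\dots\ge\lambda_{q-1}(r)$; the standard form of a code's representation matrix is obtained by permuting symbols separately within each row. $N_q(t)$ is the minimum $n\ge2$ such that there exists a wide-sense $t$-frameproof code $\mathcal C\subseteq Q^n$ with $|\mathcal C|>n$. $N'_q(t)$ is the smallest $n\ge3$ such that there exists a wide-sense $t$-frameproof code in $Q^n$ of size $n$ whose representation matrix in standard form is not a permutation matrix. -}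

module Defs where

open import Data.Nat using (ℕ; _≤_; _<_)
open import Data.Fin using (Fin; toℕ) renaming (_≤_ to _≤ᶠ_)
open import Data.Fin.Properties using (_≟_)
open import Data.Fin.Subset using (Subset; _∈_; ∣_∣)
open import Data.Fin.Permutation using (Permutation′; _⟨$⟩ʳ_)
open import Data.Vec using (Vec; lookup)
open import Data.List using (length; filter; allFin)
open import Data.Product using (Σ; _×_; Σ-syntax)
open import Relation.Binary.PropositionalEquality using (_≡_; _≢_)
open import Relation.Nullary using (¬_)
open import Function.Definitions using (Injective)

-- A code of size m in Q^n (Q = Fin q) is given by an injective
-- indexing  c : Fin m → Vec (Fin q) n  of its (distinct) codewords.
Codewords : ℕ → ℕ → ℕ → Set
Codewords q n m = Fin m → Vec (Fin q) n

IsCode : ∀ {q n m} → Codewords q n m → Set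
IsCode c = Injective _≡_ _≡_ c

-- i ∈ U(X), for X = { c j | j ∈ S }
InU : ∀ {q n m} → Codewords q n m → Subset m → Fin n → Set
InU c S i = ∀ j j' → j ∈ S → j' ∈ S → lookup (c j) i ≡ lookup (c j') i

InWdesc : ∀ {q n m} → Codewords q n m → Subset m → Vec (Fin q) n → Set
InWdesc c S y = ∀ i → InU c S i → ∀ j → j ∈ S → lookup y i ≡ lookup (c j) i

-- wide-sense t-frameproof: for every nonempty X ⊆ C with |X| ≤ t,
-- wdesc(X) ∩ C = X  (the inclusion X ⊆ wdesc(X) ∩ C always holds).
WideSenseFP : ∀ {q n m} → ℕ → Codewords q n m → Set
WideSenseFP {m = m} t c =
  (S : Subset m) → 1 ≤ ∣ S ∣ → ∣ S ∣ ≤ t →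
  (k : Fin m) → InWdesc c S (c k) → k ∈ S

Matrix : ℕ → ℕ → ℕ → Set
Matrix q n m = Fin n → Fin m → Fin q

repMatrix : ∀ {q n m} → Codewords q n m → Matrix q n m
repMatrix c r j = lookup (c j) r

rowCount : ∀ {q n m} → Matrix q n m → Fin n → Fin q → ℕ
rowCount {m = m} M r i = length (filter (λ j → M r j ≟ i) (allFin m))

IsStandardForm : ∀ {q n m} → Matrix q n m → Set
IsStandardForm {q} {n} M =
  (r : Fin n) (i i' : Fin q) → i ≤ᶠ i' → rowCount M r i' ≤ rowCount M r i

IsStandardFormOf : ∀ {q n m} → Matrix q n m → Matrix q n m → Set
IsStandardFormOf {q} {n} {m} M M' =
  Σ[ σ ∈ (Fin n → Permutation′ q) ]
    ((r : Fin n) (j : Fin m) → M' r j ≡ σ r ⟨$⟩ʳ M r j)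
  × IsStandardForm M'

IsPermutationMatrix : ∀ {q n} → Matrix q n n → Set
IsPermutationMatrix {q} {n} M =
  Σ[ π ∈ Permutation′ n ] ((r j : Fin n) →
      (j ≡ π ⟨$⟩ʳ r → toℕ (M r j) ≡ 1)
    × (j ≢ π ⟨$⟩ʳ r → toℕ (M r j) ≡ 0))

-- property defining N_q(t): n ≥ 2 and there is a wide-sense t-FP code
-- C ⊆ Q^n with |C| > n
HasLargeFPCode : ℕ → ℕ → ℕ → Set
HasLargeFPCode q t n =
  2 ≤ n × Σ[ m ∈ ℕ ] (n < m × Σ[ c ∈ Codewords q n m ] (IsCode c × WideSenseFP t c))

-- property defining N'_q(t): n ≥ 3 and there is a wide-sense t-FP code in
-- Q^n of size n whose representation matrix in standard form is not a
-- permutation matrix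
HasNonPermFPCode : ℕ → ℕ → ℕ → Set
HasNonPermFPCode q t n =
  3 ≤ n × Σ[ c ∈ Codewords q n n ]
    (IsCode c × WideSenseFP t c ×
     ((M' : Matrix q n n) → IsStandardFormOf (repMatrix c) M' → ¬ IsPermutationMatrix M'))

IsLeast : (ℕ → Set) → ℕ → Set
IsLeast P N = P N × ((n : ℕ) → P n → N ≤ n)

{-# OPTIONS --safe #-}
-- Deleting codewords preserves the wide-sense frameproof property, so a frameproof code of
-- length N with more than N codewords yields one, W = w₀ … w_N, with exactly N + 1.
-- N = 2 is impossible: for each of three codewords, frameproofness for the other two gives a
-- row in which only that codeword differs, and these three rows are distinct.
-- For N ≥ 3 note that renaming symbols turns a row into a row of a permutation matrix iff the
-- row has an outlier: one entry differs from all the others, which agree. Let r be a row in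
-- which w₁, w₂, w₃ agree and w₀ does not. If w₁, …, w_N all agree in row r, deleting w₀ leaves
-- a constant row; otherwise some w_j with j ≥ 4 dissents as well, and deleting w₁ leaves a
-- row with two dissenters. Either way N codewords remain whose matrix has no permutation
-- standard form. Every property involved is decidable by exhaustive search, so the least
-- length with such a code exists, and it is at most N.
module Submission where

open import Defs
open import Data.Nat.Base using (ℕ; zero; suc; _+_; _∸_; _≤_; _<_; z≤n; s≤s; s≤s⁻¹; _≤′_; ≤′-refl; ≤′-step; 2+)
open import Data.Nat.Properties
  using (_≤?_; ≤-refl; ≤-trans; ≤-reflexive; <⇒≤; ≮⇒≥; ≤⇒≤′; m≤n⇒m≤1+n; 0≢1+n; 1+n≰n; anyUpTo?)
open import Data.Nat.Induction using (<-rec)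
open import Data.Empty using (⊥; ⊥-elim)
open import Data.Fin.Base using (Fin; zero; suc; toℕ; punchIn; punchOut) renaming (_≤_ to _≤ᶠ_)
open import Data.Fin.Patterns using (0F; 1F; 2F; 3F)
open import Data.Fin.Properties
  using (_≟_; any?; all?; ¬∀⟶∃¬; toℕ-injective; suc-injective; punchIn-injective; punchInᵢ≢i;
         punchOut-injective; punchIn-punchOut; injective⇒≤; <⇒notInjective)
open import Data.Fin.Subset using (Subset; _∈_; _∉_; ∣_∣; ⁅_⁆; ∁; inside; outside) renaming (⊥ to ∅)
open import Data.Fin.Subset.Properties
  using (_∈?_; anySubset?; x∈⁅x⁆; x∈⁅y⁆⇒x≡y; x∈p⇒x∉∁p; x∉p⇒x∈∁p; ∣∁p∣≡n∸∣p∣; ∣⁅x⁆∣≡1; ∣⊥∣≡0)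
open import Data.Fin.Permutation using (Permutation; Permutation′; _⟨$⟩ʳ_; _⟨$⟩ˡ_; permutation; inverseˡ; inverseʳ; insert; insert-punchIn) renaming (id to idₚ)
open import Data.Vec.Base using (Vec; []; _∷_; lookup; tabulate; insertAt; here; there)
open import Data.Vec.Properties using (lookup∘tabulate; insertAt-lookup; insertAt-punchIn; []=⇒lookup; lookup⇒[]=; ≡-dec)
open import Data.List.Base using (List; []; _∷_; length; filter)
open import Data.List.Properties using (filter-none; filter-some)
import Data.List.Relation.Unary.All as All
import Data.List.Relation.Unary.All.Properties as All
import Data.List.Relation.Unary.Any.Properties as Any
open import Data.List.Relation.Unary.Unique.Propositional using (Unique; []; _∷_)
open import Data.List.Relation.Unary.Unique.Propositional.Properties using (allFin⁺)
open import Data.Product.Base using (Σ-syntax; ∃; _×_; _,_; proj₁; proj₂)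
open import Data.Sum.Base using (_⊎_; inj₁; inj₂; [_,_]′)
open import Function.Base using (_∘_; const; id)
open import Function.Bundles using (Injection)
open import Function.Definitions using (Injective)
open import Function.Properties.Inverse using (↔⇒↣)
open import Level using (0ℓ)
open import Relation.Binary.Definitions using (DecidableEquality)
open import Relation.Binary.PropositionalEquality
  using (_≡_; _≢_; refl; sym; trans; cong; subst; ≢-sym; _≗_; module ≡-Reasoning)
open import Relation.Nullary.Decidable using (Dec; yes; no; map′; ¬?; _×-dec_; _→-dec_; decidable-stable)
open import Relation.Nullary.Negation using (¬_; contradiction)
open import Relation.Unary using (Pred; Decidable)

Searchable : Set → Set₁
Searchable A = ∀ {P : Pred A 0ℓ} → Decidable P → Dec (∃ P)

∃-Vec? : ∀ {A} → Searchable A → ∀ n → Searchable (Vec A n)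
∃-Vec? search zero    P? = map′ ([] ,_) (λ { ([] , p) → p }) (P? [])
∃-Vec? search (suc n) P? =
  map′ (λ (a , v , p) → a ∷ v , p) (λ { (a ∷ v , p) → a , v , p })
       (search λ a → ∃-Vec? search n (P? ∘ (a ∷_)))

-- Functions are searched through their tables, hence P must respect ≗.
∃-Fin→? : ∀ {A} → Searchable A → ∀ m {P : Pred (Fin m → A) 0ℓ} →
          (∀ {f g} → f ≗ g → P f → P g) → Decidable P → Dec (∃ P)
∃-Fin→? search m resp P? =
  map′ (λ (v , p) → lookup v , p)
       (λ (f , p) → tabulate f , resp (sym ∘ lookup∘tabulate f) p)
       (∃-Vec? search m (P? ∘ lookup))

allSubset? : ∀ {n} {P : Pred (Subset n) 0ℓ} → Decidable P → Dec (∀ S → P S)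
allSubset? P? =
  map′ (λ ∄¬P S → decidable-stable (P? S) (λ ¬PS → ∄¬P (S , ¬PS)))
       (λ ∀P (S , ¬PS) → ¬PS (∀P S))
       (¬? (anySubset? (¬? ∘ P?)))

injective? : ∀ {m} {B : Set} → DecidableEquality B → (f : Fin m → B) → Dec (Injective _≡_ _≡_ f)
injective? _≟ᴮ_ f =
  map′ (λ inj {x} {y} → inj x y) (λ inj x y → inj)
       (all? λ x → all? λ y → (f x ≟ᴮ f y) →-dec (x ≟ y))

least-≤ : ∀ {P : Pred ℕ 0ℓ} → Decidable P → ∀ {n} → P n → Σ[ N ∈ ℕ ] (IsLeast P N × N ≤ n)
least-≤ {P} P? {n} = <-rec Goal step n
  where
  Goal : ℕ → Set
  Goal n = P n → Σ[ N ∈ ℕ ] (IsLeast P N × N ≤ n)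

  step : ∀ n → (∀ {m} → m < n → Goal m) → Goal n
  step n below Pn with anyUpTo? P? n
  ... | yes (m , m<n , Pm) = let N , least , N≤m = below m<n Pm in N , least , ≤-trans N≤m (<⇒≤ m<n)
  ... | no ∄m<n = n , (Pn , λ m Pm → ≮⇒≥ λ m<n → ∄m<n (m , m<n , Pm)) , ≤-refl

≢-cotransitive : ∀ {n} {x y : Fin n} → x ≢ y → ∀ z → x ≢ z ⊎ y ≢ z
≢-cotransitive {x = x} x≢y z with x ≟ z
... | yes refl = inj₂ (x≢y ∘ sym)
... | no x≢z   = inj₁ x≢z

injective⇒surjective : ∀ {n} {f : Fin n → Fin n} → Injective _≡_ _≡_ f → ∀ y → ∃ λ x → f x ≡ y
injective⇒surjective {suc n} {f} f-injective y with any? (λ x → f x ≟ y)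
... | yes hit = hit
... | no miss = ⊥-elim (<⇒notInjective {f = f∖y} ≤-refl f∖y-injective)
  where
  y≢f : ∀ x → y ≢ f x
  y≢f x = miss ∘ (x ,_) ∘ sym

  f∖y : Fin (suc n) → Fin n
  f∖y x = punchOut (y≢f x)

  f∖y-injective : Injective _≡_ _≡_ f∖y
  f∖y-injective {x} {x′} = f-injective ∘ punchOut-injective (y≢f x) (y≢f x′)

injective⇒permutation : ∀ {n} {f : Fin n → Fin n} → Injective _≡_ _≡_ f → Permutation′ n
injective⇒permutation {f = f} f-injective =
  permutation f (proj₁ ∘ surjective) (proj₂ ∘ surjective) (λ x → f-injective (proj₂ (surjective (f x))))
  where
  surjective : ∀ y → ∃ λ x → f x ≡ y
  surjective = injective⇒surjective f-injective

insert-here : ∀ {m n} (i : Fin (suc m)) (j : Fin (suc n)) (π : Permutation m n) → insert i j π ⟨$⟩ʳ i ≡ j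
insert-here i j π with i ≟ i
... | yes _   = refl
... | no i≢i = contradiction refl i≢i

permutation-0-1 : ∀ {q} {a b : Fin (2+ q)} → a ≢ b → Σ[ σ ∈ Permutation′ (2+ q) ] (σ ⟨$⟩ʳ a ≡ 0F × σ ⟨$⟩ʳ b ≡ 1F)
permutation-0-1 {q} {a} {b} a≢b = σ , insert-here a 0F _ , σb≡1
  where
  open ≡-Reasoning

  b′ : Fin (suc q)
  b′ = punchOut a≢b

  σ : Permutation′ (2+ q)
  σ = insert a 0F (insert b′ 0F idₚ)

  σb≡1 : σ ⟨$⟩ʳ b ≡ 1F
  σb≡1 = begin
    σ ⟨$⟩ʳ b                               ≡⟨ cong (σ ⟨$⟩ʳ_) (sym (punchIn-punchOut a≢b)) ⟩
    σ ⟨$⟩ʳ punchIn a b′                    ≡⟨ insert-punchIn a 0F _ b′ ⟩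
    punchIn 0F (insert b′ 0F idₚ ⟨$⟩ʳ b′)   ≡⟨ cong suc (insert-here b′ 0F idₚ) ⟩
    1F                                     ∎

module _ {A : Set} where

  OutlierAt : ∀ {m} → (Fin m → A) → Fin m → Set
  OutlierAt v p = Σ[ a ∈ A ] (v p ≢ a × (∀ j → j ≢ p → v j ≡ a))

  HasOutlier : ∀ {m} → (Fin m → A) → Set
  HasOutlier v = ∃ (OutlierAt v)

  ¬HasOutlier-constant : ∀ {m a} {v : Fin (2+ m) → A} → (∀ j → v j ≡ a) → ¬ HasOutlier v
  ¬HasOutlier-constant v≡a (p , b , vp≢b , others≡b) =
    vp≢b (trans (v≡a p) (trans (sym (v≡a j)) (others≡b j (punchInᵢ≢i p 0F))))
    where
    j : Fin _
    j = punchIn p 0F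

  ¬HasOutlier-dissenters : ∀ {m} {v : Fin m → A} {x y z z′} → x ≢ y → v x ≡ v y →
                           z ≢ z′ → v z ≢ v x → v z′ ≢ v x → ¬ HasOutlier v
  ¬HasOutlier-dissenters {v = v} {x} {y} {z} {z′} x≢y vx≡vy z≢z′ vz≢vx vz′≢vx (p , b , _ , others≡b) =
    [ dissent vz≢vx , dissent vz′≢vx ]′ (≢-cotransitive z≢z′ p)
    where
    vx≡b : v x ≡ b
    vx≡b = [ others≡b x , (λ y≢p → trans vx≡vy (others≡b y y≢p)) ]′ (≢-cotransitive x≢y p)

    dissent : ∀ {w} → v w ≢ v x → w ≢ p → ⊥
    dissent vw≢vx w≢p = vw≢vx (trans (others≡b _ w≢p) (sym vx≡b))

  deletion-¬HasOutlier : DecidableEquality A → ∀ {k} {v : Fin (4 + k) → A} →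
                         v 2F ≡ v 1F → v 3F ≡ v 1F → v 0F ≢ v 1F → ∃ λ a → ¬ HasOutlier (v ∘ punchIn a)
  deletion-¬HasOutlier _≟ᴬ_ {k} {v} v₂≡v₁ v₃≡v₁ v₀≢v₁ with all? (λ j → v (suc j) ≟ᴬ v 1F)
  ... | yes constant = 0F , ¬HasOutlier-constant constant
  ... | no ¬constant with ¬∀⟶∃¬ _ _ (λ j → v (suc j) ≟ᴬ v 1F) ¬constant
  ...   | 0F , v₁≢v₁ = contradiction refl v₁≢v₁
  ...   | 1F , v₂≢v₁ = contradiction v₂≡v₁ v₂≢v₁
  ...   | 2F , v₃≢v₁ = contradiction v₃≡v₁ v₃≢v₁
  ...   | suc (suc (suc j)) , vⱼ≢v₁ =
    1F , ¬HasOutlier-dissenters {x = 1F} {2F} {0F} {suc (suc (suc j))}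
           (λ ()) (trans v₂≡v₁ (sym v₃≡v₁)) (λ ()) (v₀≢v₁ ∘ (λ e → trans e v₂≡v₁)) (vⱼ≢v₁ ∘ (λ e → trans e v₂≡v₁))

PermutationLike : ∀ {q n} → Matrix q n n → Set
PermutationLike {n = n} M = Σ[ f ∈ (Fin n → Fin n) ] (Injective _≡_ _≡_ f × (∀ r → OutlierAt (M r) (f r)))

HasPermutationStandardForm : ∀ {q n} → Matrix q n n → Set
HasPermutationStandardForm {q} {n} M = Σ[ M′ ∈ Matrix q n n ] (IsStandardFormOf M M′ × IsPermutationMatrix M′)

NoPermutationStandardForm : ∀ {q n} → Matrix q n n → Set
NoPermutationStandardForm {q} {n} M = (M′ : Matrix q n n) → IsStandardFormOf M M′ → ¬ IsPermutationMatrix M′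

OnesExactlyAt : ∀ {q n m} → Matrix (2+ q) n m → (Fin n → Fin m) → Set
OnesExactlyAt M f = ∀ r j → (j ≡ f r → M r j ≡ 1F) × (j ≢ f r → M r j ≡ 0F)

length-filter≤1 : ∀ {A : Set} {P : Pred A 0ℓ} (P? : Decidable P) {xs : List A} → Unique xs →
                  (∀ {x y} → P x → P y → x ≡ y) → length (filter P? xs) ≤ 1
length-filter≤1 P? [] _ = z≤n
length-filter≤1 P? {x ∷ xs} (x∉xs ∷ xs-unique) P-unique with P? x
... | yes Px rewrite filter-none P? (All.map (λ x≢y Py → x≢y (P-unique Px Py)) x∉xs) = s≤s z≤n
... | no _   = length-filter≤1 P? xs-unique P-unique

onesExactlyAt⇒standardForm : ∀ {q n m} {M : Matrix (2+ q) n (2+ m)} {f} → OnesExactlyAt M f → IsStandardForm M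
onesExactlyAt⇒standardForm {q} {M = M} {f} ones r = antitone
  where
  count : Fin (2+ q) → ℕ
  count = rowCount M r

  one⇒at : ∀ {j} → M r j ≡ 1F → j ≡ f r
  one⇒at {j} Mrj≡1 with j ≟ f r
  ... | yes j≡fr = j≡fr
  ... | no j≢fr  = contradiction (trans (sym (proj₂ (ones r j) j≢fr)) Mrj≡1) λ ()

  ones≤1 : count 1F ≤ 1
  ones≤1 = length-filter≤1 (λ j → M r j ≟ 1F) (allFin⁺ _) λ e e′ → trans (one⇒at e) (sym (one⇒at e′))

  zeros≥1 : 1 ≤ count 0F
  zeros≥1 = filter-some (λ j → M r j ≟ 0F)
              (Any.tabulate⁺ {f = id} (punchIn (f r) 0F) (proj₂ (ones r _) (punchInᵢ≢i (f r) 0F)))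

  others≡0 : ∀ k → count (suc (suc k)) ≡ 0
  others≡0 k = cong length (filter-none (λ j → M r j ≟ suc (suc k)) (All.tabulate⁺ {f = id} not-2+k))
    where
    not-2+k : ∀ j → M r j ≢ suc (suc k)
    not-2+k j with j ≟ f r
    ... | yes j≡fr = λ e → contradiction (trans (sym (proj₁ (ones r j) j≡fr)) e) λ ()
    ... | no j≢fr  = λ e → contradiction (trans (sym (proj₂ (ones r j) j≢fr)) e) λ ()

  antitone : ∀ i i′ → i ≤ᶠ i′ → count i′ ≤ count i
  antitone 0F            0F       _        = ≤-refl
  antitone (suc _)       0F       ()
  antitone 0F            1F       _        = ≤-trans ones≤1 zeros≥1
  antitone 1F            1F       _        = ≤-refl
  antitone (suc (suc _)) 1F       (s≤s ())
  antitone i     (suc (suc k))   _        = ≤-trans (≤-reflexive (others≡0 k)) z≤n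

onesExactlyAt⇒permutationMatrix : ∀ {q n} {M : Matrix (2+ q) n n} (π : Permutation′ n) →
                                  OnesExactlyAt M (π ⟨$⟩ʳ_) → IsPermutationMatrix M
onesExactlyAt⇒permutationMatrix π ones = π , λ r j → cong toℕ ∘ proj₁ (ones r j) , cong toℕ ∘ proj₂ (ones r j)

hasPermutationStandardForm⇒permutationLike : ∀ {q n} {M : Matrix (suc q) n n} →
                                             HasPermutationStandardForm M → PermutationLike M
hasPermutationStandardForm⇒permutationLike {M = M} (M′ , (σ , M′≡σM , _) , π , ones) =
  (π ⟨$⟩ʳ_) , Injection.injective (↔⇒↣ π) , outlier
  where

  outlier : ∀ r → OutlierAt (M r) (π ⟨$⟩ʳ r)
  outlier r = σ r ⟨$⟩ˡ 0F , Mp≢a , λ j j≢p → zero⇒a j (proj₂ (ones r j) j≢p)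
    where
    open ≡-Reasoning

    zero⇒a : ∀ j → toℕ (M′ r j) ≡ 0 → M r j ≡ σ r ⟨$⟩ˡ 0F
    zero⇒a j M′rj≡0 = begin
      M r j                      ≡⟨ sym (inverseˡ (σ r)) ⟩
      σ r ⟨$⟩ˡ (σ r ⟨$⟩ʳ M r j)  ≡⟨ cong (σ r ⟨$⟩ˡ_) (sym (M′≡σM r j)) ⟩
      σ r ⟨$⟩ˡ M′ r j            ≡⟨ cong (σ r ⟨$⟩ˡ_) (toℕ-injective M′rj≡0) ⟩
      σ r ⟨$⟩ˡ 0F                ∎

    Mp≢a : M r (π ⟨$⟩ʳ r) ≢ σ r ⟨$⟩ˡ 0F
    Mp≢a Mp≡a = 0≢1+n (trans (sym (cong toℕ M′p≡0)) (proj₁ (ones r _) refl))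
      where
      M′p≡0 : M′ r (π ⟨$⟩ʳ r) ≡ 0F
      M′p≡0 = trans (M′≡σM r _) (trans (cong (σ r ⟨$⟩ʳ_) Mp≡a) (inverseʳ (σ r)))

¬permutationLike⇒noPermutationStandardForm : ∀ {q n} {M : Matrix (suc q) n n} →
                                             ¬ PermutationLike M → NoPermutationStandardForm M
¬permutationLike⇒noPermutationStandardForm ¬permutationLike M′ standard permutation =
  ¬permutationLike (hasPermutationStandardForm⇒permutationLike (M′ , standard , permutation))

permutationLike⇒hasPermutationStandardForm : ∀ {q n} {M : Matrix (2+ q) (2+ n) (2+ n)} →
                                             PermutationLike M → HasPermutationStandardForm M
permutationLike⇒hasPermutationStandardForm {q} {n} {M} (f , f-injective , outlier) =
  M′ , (σ , (λ r j → refl) , onesExactlyAt⇒standardForm ones) ,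
  onesExactlyAt⇒permutationMatrix (injective⇒permutation f-injective) ones
  where
  normalise : ∀ r → Σ[ σ ∈ Permutation′ (2+ q) ] (σ ⟨$⟩ʳ proj₁ (outlier r) ≡ 0F × σ ⟨$⟩ʳ M r (f r) ≡ 1F)
  normalise r = permutation-0-1 (≢-sym (proj₁ (proj₂ (outlier r))))

  σ : Fin (2+ n) → Permutation′ (2+ q)
  σ r = proj₁ (normalise r)

  M′ : Matrix (2+ q) (2+ n) (2+ n)
  M′ r j = σ r ⟨$⟩ʳ M r j

  ones : OnesExactlyAt M′ f
  ones r j = (λ j≡fr → subst (λ j → M′ r j ≡ 1F) (sym j≡fr) (proj₂ (proj₂ (normalise r))))
           , (λ j≢fr → trans (cong (σ r ⟨$⟩ʳ_) (proj₂ (proj₂ (outlier r)) j j≢fr)) (proj₁ (proj₂ (normalise r))))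

outlierAt? : ∀ {q m} (v : Fin m → Fin q) p → Dec (OutlierAt v p)
outlierAt? v p = any? λ a → ¬? (v p ≟ a) ×-dec all? λ j → ¬? (j ≟ p) →-dec (v j ≟ a)

permutationLike? : ∀ {q n} (M : Matrix q n n) → Dec (PermutationLike M)
permutationLike? {n = n} M =
  ∃-Fin→? any? n resp λ f → injective? _≟_ f ×-dec all? λ r → outlierAt? (M r) (f r)
  where
  resp : ∀ {f g} → f ≗ g → Injective _≡_ _≡_ f × (∀ r → OutlierAt (M r) (f r)) →
                           Injective _≡_ _≡_ g × (∀ r → OutlierAt (M r) (g r))
  resp f≗g (f-injective , outlier) =
    (λ e → f-injective (trans (f≗g _) (trans e (sym (f≗g _))))) , λ r → subst (OutlierAt (M r)) (f≗g r) (outlier r)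

noPermutationStandardForm? : ∀ {q n} (M : Matrix (2+ q) (2+ n) (2+ n)) → Dec (NoPermutationStandardForm M)
noPermutationStandardForm? M =
  map′ ¬permutationLike⇒noPermutationStandardForm
       (λ noPermutation permutationLike →
          let M′ , standard , permutation = permutationLike⇒hasPermutationStandardForm permutationLike
          in  noPermutation M′ standard permutation)
       (¬? (permutationLike? M))

inU? : ∀ {q n m} (c : Codewords q n m) S i → Dec (InU c S i)
inU? c S i = all? λ j → all? λ j′ → (j ∈? S) →-dec (j′ ∈? S) →-dec (lookup (c j) i ≟ lookup (c j′) i)

inWdesc? : ∀ {q n m} (c : Codewords q n m) S y → Dec (InWdesc c S y)
inWdesc? c S y = all? λ i → inU? c S i →-dec all? λ j → (j ∈? S) →-dec (lookup y i ≟ lookup (c j) i)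

wideSenseFP? : ∀ {q n m} t (c : Codewords q n m) → Dec (WideSenseFP t c)
wideSenseFP? t c =
  allSubset? λ S → (1 ≤? ∣ S ∣) →-dec (∣ S ∣ ≤? t) →-dec all? λ k → inWdesc? c S (c k) →-dec (k ∈? S)

module _ {q n m} {c c′ : Codewords q n m} (c≗c′ : c ≗ c′) where

  private
    entry : ∀ j i → lookup (c j) i ≡ lookup (c′ j) i
    entry j i = cong (λ w → lookup w i) (c≗c′ j)

  isCode-resp : IsCode c → IsCode c′
  isCode-resp c-code e = c-code (trans (c≗c′ _) (trans e (sym (c≗c′ _))))

  wideSenseFP-resp : ∀ {t} → WideSenseFP t c → WideSenseFP t c′
  wideSenseFP-resp fp S 1≤∣S∣ ∣S∣≤t k w′ = fp S 1≤∣S∣ ∣S∣≤t k w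
    where
    w : InWdesc c S (c k)
    w i u j j∈S = trans (entry k i) (trans (w′ i u′ j j∈S) (sym (entry j i)))
      where
      u′ : InU c′ S i
      u′ j j′ j∈S j′∈S = trans (sym (entry j i)) (trans (u j j′ j∈S j′∈S) (entry j′ i))

noPermutationStandardForm-resp : ∀ {q n} {c c′ : Codewords q n n} → c ≗ c′ →
                                 NoPermutationStandardForm (repMatrix c) → NoPermutationStandardForm (repMatrix c′)
noPermutationStandardForm-resp {c = c} c≗c′ noPermutation M′ (σ , M′≡σM , standard) =
  noPermutation M′ (σ , M′≡σM′ , standard)
  where
  M′≡σM′ : ∀ r j → M′ r j ≡ σ r ⟨$⟩ʳ lookup (c j) r
  M′≡σM′ r j = trans (M′≡σM r j) (cong (λ w → σ r ⟨$⟩ʳ lookup w r) (sym (c≗c′ j)))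

∣insertAt-outside∣ : ∀ {m} (S : Subset m) i → ∣ insertAt S i outside ∣ ≡ ∣ S ∣
∣insertAt-outside∣ S             zero    = refl
∣insertAt-outside∣ (inside ∷ S)  (suc i) = cong suc (∣insertAt-outside∣ S i)
∣insertAt-outside∣ (outside ∷ S) (suc i) = ∣insertAt-outside∣ S i

∈-insertAt⁺ : ∀ {m} {S : Subset m} {x} i b → x ∈ S → punchIn i x ∈ insertAt S i b
∈-insertAt⁺ {S = S} {x} i b x∈S = lookup⇒[]= _ _ (trans (insertAt-punchIn S i b x) ([]=⇒lookup x∈S))

∈-insertAt-outside⁻ : ∀ {m} {S : Subset m} i {y} → y ∈ insertAt S i outside → ∃ λ x → punchIn i x ≡ y × x ∈ S
∈-insertAt-outside⁻ {S = S} i {y} y∈S⁺ with i ≟ y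
... | yes refl = contradiction (trans (sym (insertAt-lookup S i outside)) ([]=⇒lookup y∈S⁺)) λ ()
... | no i≢y   = punchOut i≢y , punchIn-punchOut i≢y , lookup⇒[]= _ S (begin
  lookup S (punchOut i≢y)                                  ≡⟨ sym (insertAt-punchIn S i outside _) ⟩
  lookup (insertAt S i outside) (punchIn i (punchOut i≢y)) ≡⟨ cong (lookup (insertAt S i outside)) (punchIn-punchOut i≢y) ⟩
  lookup (insertAt S i outside) y                          ≡⟨ []=⇒lookup y∈S⁺ ⟩
  inside                                                   ∎)
  where open ≡-Reasoning

-- S ⊆ Fin m corresponds to S⁺ ⊆ Fin (suc m), which has the same size but leaves out i.
wideSenseFP-punchIn : ∀ {q n m t} (c : Codewords q n (suc m)) i → WideSenseFP t c → WideSenseFP t (c ∘ punchIn i)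
wideSenseFP-punchIn {t = t} c i fp S 1≤∣S∣ ∣S∣≤t k w = k∈S
  where
  S⁺ : Subset (suc _)
  S⁺ = insertAt S i outside

  1≤∣S⁺∣ : 1 ≤ ∣ S⁺ ∣
  1≤∣S⁺∣ = subst (1 ≤_) (sym (∣insertAt-outside∣ S i)) 1≤∣S∣

  ∣S⁺∣≤t : ∣ S⁺ ∣ ≤ t
  ∣S⁺∣≤t = subst (_≤ t) (sym (∣insertAt-outside∣ S i)) ∣S∣≤t

  w⁺ : InWdesc c S⁺ (c (punchIn i k))
  w⁺ r u⁺ y y∈S⁺ with x , refl , x∈S ← ∈-insertAt-outside⁻ i y∈S⁺ =
    w r (λ j j′ j∈S j′∈S → u⁺ _ _ (∈-insertAt⁺ i outside j∈S) (∈-insertAt⁺ i outside j′∈S)) x x∈S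

  k∈S : k ∈ S
  k∈S with x , punchInx≡punchInk , x∈S ← ∈-insertAt-outside⁻ i (fp S⁺ 1≤∣S⁺∣ ∣S⁺∣≤t (punchIn i k) w⁺) =
    subst (_∈ S) (punchIn-injective i x k punchInx≡punchInk) x∈S

subcode : ∀ {q n m m′ t} → m′ ≤′ m → (c : Codewords q n m) → IsCode c → WideSenseFP t c →
          Σ[ c′ ∈ Codewords q n m′ ] (IsCode c′ × WideSenseFP t c′)
subcode ≤′-refl         c c-code fp = c , c-code , fp
subcode (≤′-step m′≤′m) c c-code fp =
  subcode m′≤′m (c ∘ suc) (suc-injective ∘ c-code) (wideSenseFP-punchIn c 0F fp)

separatingRow : ∀ {q n m t} (c : Codewords q n m) → WideSenseFP t c → (S : Subset m) → 1 ≤ ∣ S ∣ → ∣ S ∣ ≤ t →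
                ∀ {k x} → k ∉ S → x ∈ S → Σ[ i ∈ Fin n ] (InU c S i × lookup (c k) i ≢ lookup (c x) i)
separatingRow {n = n} c fp S 1≤∣S∣ ∣S∣≤t {k} {x} k∉S x∈S =
  row (¬∀⟶∃¬ n _ (λ i → inU? c S i →-dec (lookup (c k) i ≟ lookup (c x) i)) ¬agree)
  where
  ¬agree : ¬ (∀ i → InU c S i → lookup (c k) i ≡ lookup (c x) i)
  ¬agree agree = k∉S (fp S 1≤∣S∣ ∣S∣≤t k λ i u j j∈S → trans (agree i u) (u x j x∈S j∈S))

  row : (∃ λ i → ¬ (InU c S i → lookup (c k) i ≡ lookup (c x) i)) →
        Σ[ i ∈ Fin n ] (InU c S i × lookup (c k) i ≢ lookup (c x) i)
  row (i , ¬[u⇒agree]) with inU? c S i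
  ... | yes u = i , u , ¬[u⇒agree] ∘ const
  ... | no ¬u = contradiction (λ u → contradiction u ¬u) ¬[u⇒agree]

∃-≢-≢ : ∀ {m} (x y : Fin (3 + m)) → ∃ λ z → z ≢ x × z ≢ y
∃-≢-≢ x y with x ≟ y
... | yes refl = punchIn x 0F , punchInᵢ≢i x 0F , punchInᵢ≢i x 0F
... | no x≢y   = punchIn x (punchIn y′ 0F) , punchInᵢ≢i x _ , λ z≡y →
  punchInᵢ≢i y′ 0F (punchIn-injective x _ _ (trans z≡y (sym (punchIn-punchOut x≢y))))
  where
  y′ : Fin (2+ _)
  y′ = punchOut x≢y

-- Distinct codewords k are separated from all the others by distinct rows.
size≤length : ∀ {q n m t} → 3 ≤ m → m ≤ suc t → (c : Codewords q n m) → WideSenseFP t c → m ≤ n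
size≤length {n = n} {suc (suc (suc m))} {t} (s≤s (s≤s (s≤s _))) m≤1+t c fp =
  injective⇒≤ {f = row} row-injective
  where
  open ≡-Reasoning

  ∈others : ∀ {k x} → x ≢ k → x ∈ ∁ ⁅ k ⁆
  ∈others {k} x≢k = x∉p⇒x∈∁p (x≢k ∘ x∈⁅y⁆⇒x≡y k)

  ∣others∣ : ∀ k → ∣ ∁ ⁅ k ⁆ ∣ ≡ 2 + m
  ∣others∣ k = trans (∣∁p∣≡n∸∣p∣ ⁅ k ⁆) (cong (3 + m ∸_) (∣⁅x⁆∣≡1 k))

  separation : ∀ k → Σ[ i ∈ Fin n ] (InU c (∁ ⁅ k ⁆) i × lookup (c k) i ≢ lookup (c (punchIn k 0F)) i)
  separation k = separatingRow c fp (∁ ⁅ k ⁆)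
    (subst (1 ≤_) (sym (∣others∣ k)) (s≤s z≤n)) (subst (_≤ t) (sym (∣others∣ k)) (s≤s⁻¹ m≤1+t))
    (x∈p⇒x∉∁p (x∈⁅x⁆ k)) (∈others (punchInᵢ≢i k 0F))

  row : Fin (3 + m) → Fin n
  row k = proj₁ (separation k)

  agree : ∀ k {x y} → x ≢ k → y ≢ k → lookup (c x) (row k) ≡ lookup (c y) (row k)
  agree k x≢k y≢k = proj₁ (proj₂ (separation k)) _ _ (∈others x≢k) (∈others y≢k)

  differ : ∀ k {x} → x ≢ k → lookup (c k) (row k) ≢ lookup (c x) (row k)
  differ k x≢k e = proj₂ (proj₂ (separation k)) (trans e (agree k x≢k (punchInᵢ≢i k 0F)))

  row-injective : Injective _≡_ _≡_ row
  row-injective {k} {k′} row≡ = decidable-stable (k ≟ k′) λ k≢k′ →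
    let z , z≢k , z≢k′ = ∃-≢-≢ k k′ in
    differ k (k≢k′ ∘ sym) (begin
      lookup (c k) (row k)   ≡⟨ cong (lookup (c k)) row≡ ⟩
      lookup (c k) (row k′)  ≡⟨ agree k′ k≢k′ z≢k′ ⟩
      lookup (c z) (row k′)  ≡⟨ cong (lookup (c z)) (sym row≡) ⟩
      lookup (c z) (row k)   ≡⟨ agree k z≢k (k≢k′ ∘ sym) ⟩
      lookup (c k′) (row k)  ∎)

deletion-¬permutationLike : ∀ {q k t} → 3 ≤ t → (W : Codewords q (3 + k) (4 + k)) → WideSenseFP t W →
                            ∃ λ a → ¬ PermutationLike (repMatrix (W ∘ punchIn a))
deletion-¬permutationLike {k = k} {t} 3≤t W fp =
  let r , agree , w₀≢w₁ = separatingRow W fp w₁w₂w₃ (s≤s z≤n) ∣w₁w₂w₃∣≤t {0F} {1F} (λ ()) (there here)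
      a , ¬outlier = deletion-¬HasOutlier _≟_ {v = λ j → lookup (W j) r}
                       (agree 2F 1F (there (there here)) (there here))
                       (agree 3F 1F (there (there (there here))) (there here)) w₀≢w₁
  in  a , λ (_ , _ , outlier) → ¬outlier (_ , outlier r)
  where
  w₁w₂w₃ : Subset (4 + k)
  w₁w₂w₃ = outside ∷ inside ∷ inside ∷ inside ∷ ∅

  ∣w₁w₂w₃∣≤t : ∣ w₁w₂w₃ ∣ ≤ t
  ∣w₁w₂w₃∣≤t = subst (_≤ t) (sym (cong (3 +_) (∣⊥∣≡0 k))) 3≤t

deletion⇒nonPermutationCode : ∀ {q t n} (W : Codewords (suc q) (3 + n) (4 + n)) → IsCode W → WideSenseFP t W →
                              (∃ λ a → ¬ PermutationLike (repMatrix (W ∘ punchIn a))) → HasNonPermFPCode (suc q) t (3 + n)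
deletion⇒nonPermutationCode W W-code W-fp (a , ¬permutationLike) =
  s≤s (s≤s (s≤s z≤n)) , W ∘ punchIn a , (λ {x} {y} e → punchIn-injective a x y (W-code e)) ,
  wideSenseFP-punchIn W a W-fp , ¬permutationLike⇒noPermutationStandardForm ¬permutationLike

largeCode⇒nonPermutationCode : ∀ {q t n} → 3 ≤ t → HasLargeFPCode (suc q) t n → HasNonPermFPCode (suc q) t n
largeCode⇒nonPermutationCode {n = 0} _ (() , _)
largeCode⇒nonPermutationCode {n = 1} _ (s≤s () , _)
largeCode⇒nonPermutationCode {n = 2} 3≤t (_ , m , 2<m , c , c-code , fp) =
  let W , _ , W-fp = subcode (≤⇒≤′ 2<m) c c-code fp
  in  contradiction (size≤length ≤-refl (m≤n⇒m≤1+n 3≤t) W W-fp) 1+n≰n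
largeCode⇒nonPermutationCode {n = suc (suc (suc k))} 3≤t (_ , m , n<m , c , c-code , fp) =
  let W , W-code , W-fp = subcode (≤⇒≤′ n<m) c c-code fp
  in  deletion⇒nonPermutationCode W W-code W-fp (deletion-¬permutationLike 3≤t W W-fp)

hasNonPermFPCode? : ∀ q t n → Dec (HasNonPermFPCode (2+ q) t n)
hasNonPermFPCode? q t n with 3 ≤? n
... | no 3≰n = no (3≰n ∘ proj₁)
... | yes 3≤n@(s≤s (s≤s (s≤s _))) =
  map′ (3≤n ,_) proj₂ (∃-Fin→? (∃-Vec? any? n) n resp λ c →
    injective? (≡-dec _≟_) c ×-dec wideSenseFP? t c ×-dec noPermutationStandardForm? (repMatrix c))
  where
  resp : ∀ {c c′ : Codewords (2+ q) n n} → c ≗ c′ →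
         IsCode c × WideSenseFP t c × NoPermutationStandardForm (repMatrix c) →
         IsCode c′ × WideSenseFP t c′ × NoPermutationStandardForm (repMatrix c′)
  resp c≗c′ (code , fp , noPermutation) =
    isCode-resp c≗c′ code , wideSenseFP-resp c≗c′ fp , noPermutationStandardForm-resp c≗c′ noPermutation

proposition7p4 : (q t : ℕ) → 2 ≤ q → 3 ≤ t → (N : ℕ) → IsLeast (HasLargeFPCode q t) N →
    Σ[ N' ∈ ℕ ] (IsLeast (HasNonPermFPCode q t) N' × N' ≤ N)
proposition7p4 (2+ q) t (s≤s (s≤s z≤n)) 3≤t N (large , _) =
  least-≤ (hasNonPermFPCode? q t) (largeCode⇒nonPermutationCode 3≤t large)
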